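{- Let $R$ be a binary relation on a set $X$, and let $R^2=\{(x,y):xRy\land\lnot yRx\}$ and $R^4=\{(x,y):\lnot xRy\land yRx\}$. (1) $R^2$ is dense iff $R^4$ is dense. (2) If $R$ is symmetric, then $R^2$ is dense. (3) The converse of (2) fails on sets with at least 7 elements: for every set $X$ with at least 7 elements there is a relation $R$ on $X$ such that $R^2$ is dense but $R$ is not symmetric.
   Context: Write $xRy$ for $(x,y)\in R$. A relation $S$ is dense if for all $x,z$ with $xSz$ there is $y$ with $xSy$ and $ySz$. Symmetric: $xRy\to yRx$ for all $x,y$. -}

module Defs where

open import Level using (0ℓ)
open import Data.Product using (_×_; ∃; ∃-syntax; _,_)
open import Relation.Nullary using (¬_)
open import Relation.Binary.Core using (Rel)
open import Relation.Binary.Definitions using (Symmetric)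

R2 : {X : Set} → Rel X 0ℓ → Rel X 0ℓ
R2 R x y = R x y × ¬ R y x

R4 : {X : Set} → Rel X 0ℓ → Rel X 0ℓ
R4 R x y = ¬ R x y × R y x

Dense : {X : Set} → Rel X 0ℓ → Set
Dense {X} S = ∀ {x z} → S x z → ∃[ y ] (S x y × S y z)

{-# OPTIONS --safe #-}
module Submission where

-- (1) holds because R⁴ is the converse of R², and density is preserved by taking converses.
-- (2) holds vacuously: for symmetric R the relation R² is empty.
-- For (3), on an asymmetric relation R² is R itself, so it suffices to put on seven of the
-- points of X a dense asymmetric relation: the Paley tournament on ℤ/7, where i → j iff
-- j − i is a nonzero square mod 7. Squares mod 7 are closed under halving, so (i + j)/2
-- lies between i and j, and −1 is not a square, which makes the tournament asymmetric.

open import Defs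
open import Level using (0ℓ)
open import Data.Bool using (Bool; true; false; T)
open import Data.Empty using (⊥-elim)
open import Data.Fin using (Fin; zero; suc; toℕ)
open import Data.Fin.Properties using (all?)
open import Data.Nat using (ℕ; _+_; _*_; _∸_)
open import Data.Nat.DivMod using (_%_; _mod_)
open import Data.Product using (_×_; ∃-syntax; _,_; swap)
open import Function using (flip)
open import Function.Bundles using (_⇔_; _↣_; mk⇔; Injection)
open import Relation.Nullary using (¬_; Dec)
open import Relation.Nullary.Decidable using (T?; ¬?; map′; _×-dec_; _→-dec_; toWitness)
open import Relation.Binary.Core using (Rel)
open import Relation.Binary.Definitions using (Symmetric; Asymmetric)
open import Relation.Binary.PropositionalEquality using (_≡_; refl)

private
  variable
    X A : Set

Dense-resp-⇔ : {S T : Rel X 0ℓ} → (∀ {x y} → S x y → T x y) → (∀ {x y} → T x y → S x y) →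
               Dense S → Dense T
Dense-resp-⇔ S⇒T T⇒S dense t with dense (T⇒S t)
... | y , sxy , syz = y , S⇒T sxy , S⇒T syz

Dense-flip : {S : Rel X 0ℓ} → Dense S → Dense (flip S)
Dense-flip dense s with dense s
... | y , syx , szy = y , szy , syx

Dense-R2⇔Dense-R4 : (R : Rel X 0ℓ) → Dense (R2 R) ⇔ Dense (R4 R)
Dense-R2⇔Dense-R4 R = mk⇔ to from
  where
  to : Dense (R2 R) → Dense (R4 R)
  to dense = Dense-resp-⇔ swap swap (Dense-flip dense)

  from : Dense (R4 R) → Dense (R2 R)
  from dense = Dense-flip (Dense-resp-⇔ swap swap dense)

Dense-empty : {S : Rel X 0ℓ} → (∀ {x y} → ¬ S x y) → Dense S
Dense-empty empty s = ⊥-elim (empty s)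

R2-empty : {R : Rel X 0ℓ} → Symmetric R → ∀ {x y} → ¬ R2 R x y
R2-empty sym (xRy , ¬yRx) = ¬yRx (sym xRy)

Symmetric⇒Dense-R2 : {R : Rel X 0ℓ} → Symmetric R → Dense (R2 R)
Symmetric⇒Dense-R2 {R = R} sym = Dense-empty {S = R2 R} (R2-empty {R = R} sym)

R2-asym : {R : Rel X 0ℓ} → Asymmetric R → ∀ {x y} → R x y → R2 R x y
R2-asym asym xRy = xRy , asym xRy

Dense-R2-asym : {R : Rel X 0ℓ} → Asymmetric R → Dense R → Dense (R2 R)
Dense-R2-asym {R = R} asym = Dense-resp-⇔ (R2-asym {R = R} asym) (λ (xRy , _) → xRy)

asym⇒¬sym : {R : Rel X 0ℓ} {x y : X} → Asymmetric R → R x y → ¬ Symmetric R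
asym⇒¬sym asym xRy sym = asym xRy (sym xRy)

Image : (A → X) → Rel A 0ℓ → Rel X 0ℓ
Image f S x y = ∃[ i ] ∃[ j ] (f i ≡ x × f j ≡ y × S i j)

Image-dense : (f : A → X) {S : Rel A 0ℓ} → Dense S → Dense (Image f S)
Image-dense f dense (i , j , refl , refl , s) with dense s
... | k , sik , skj = f k , (i , k , refl , refl , sik) , (k , j , refl , refl , skj)

Image-asym : (f : A ↣ X) {S : Rel A 0ℓ} → Asymmetric S → Asymmetric (Image (Injection.to f) S)
Image-asym f asym (i , j , refl , refl , s) (j′ , i′ , fj′≡fj , fi′≡fi , s′)
  with Injection.injective f fj′≡fj | Injection.injective f fi′≡fi
... | refl | refl = asym s s′

isNonzeroSquare₇ : ℕ → Bool
isNonzeroSquare₇ 1 = true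
isNonzeroSquare₇ 2 = true
isNonzeroSquare₇ 4 = true
isNonzeroSquare₇ _ = false

record Paley₇ (i j : Fin 7) : Set where
  constructor paley
  field
    difference-square : T (isNonzeroSquare₇ ((toℕ j + 7 ∸ toℕ i) % 7))

-- 4 is the inverse of 2 modulo 7.
halfway : Fin 7 → Fin 7 → Fin 7
halfway i j = (4 * (toℕ i + toℕ j)) mod 7

Paley₇? : ∀ i j → Dec (Paley₇ i j)
Paley₇? i j = map′ paley Paley₇.difference-square (T? _)

Paley₇-asym : Asymmetric Paley₇
Paley₇-asym {i} {j} =
  toWitness {a? = all? λ i → all? λ j → Paley₇? i j →-dec ¬? (Paley₇? j i)} _ i j

Paley₇-dense : Dense Paley₇
Paley₇-dense {i} {j} pij = halfway i j , halfway-between i j pij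
  where
  halfway-between : ∀ i j → Paley₇ i j → Paley₇ i (halfway i j) × Paley₇ (halfway i j) j
  halfway-between = toWitness {a? = all? λ i → all? λ j →
    Paley₇? i j →-dec Paley₇? i (halfway i j) ×-dec Paley₇? (halfway i j) j} _

Fin7↣⇒Dense-R2-¬Symmetric : Fin 7 ↣ X → ∃[ R ] (Dense (R2 {X} R) × ¬ Symmetric R)
Fin7↣⇒Dense-R2-¬Symmetric f =
  R , Dense-R2-asym {R = R} asym (Image-dense (Injection.to f) Paley₇-dense)
    , asym⇒¬sym {R = R} asym (zero , suc zero , refl , refl , paley _)
  where
  R = Image (Injection.to f) Paley₇
  asym = Image-asym f Paley₇-asym

mainTheorem10 :
    ((X : Set) (R : Rel X 0ℓ) → Dense (R2 R) ⇔ Dense (R4 R))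
    × ((X : Set) (R : Rel X 0ℓ) → Symmetric R → Dense (R2 R))
    × ((X : Set) → Fin 7 ↣ X → ∃[ R ] (Dense (R2 {X} R) × ¬ Symmetric R))
mainTheorem10 =
  (λ _ R → Dense-R2⇔Dense-R4 R) ,
  (λ _ R → Symmetric⇒Dense-R2 {R = R}) ,
  (λ _ → Fin7↣⇒Dense-R2-¬Symmetric)
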